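{- Let $\beta\in[0,1]$. Suppose there exists $\pi_i\in S$ such that $|I_i|\le(1-\beta)\mathrm{AVG}$. Then $\mathrm{Obj}(\sigma_i)\le(3-2\beta)\mathrm{OPT}$.
   Context: $\mathbb{S}_d$ is the set of rankings of $[d]$; $a\prec_\pi b$ means $a$ precedes $b$ in $\pi$; Kendall tau distance $\kappa(\pi,\sigma)=|\{(a,b): a\prec_\pi b,\ b\prec_\sigma a\}|$. Fix a nonempty set $\mathcal{F}\subseteq\mathbb{S}_d$ of rankings called fair (any fairness notion). Let $S=\{\pi_1,\dots,\pi_n\}$ be the input list of $n$ rankings, $\mathrm{Obj}(\sigma)=\sum_{j=1}^n\kappa(\sigma,\pi_j)$, $\sigma^*\in\mathcal{F}$ a minimizer of $\mathrm{Obj}$ over $\mathcal{F}$, $\mathrm{OPT}=\mathrm{Obj}(\sigma^*)$, $\mathrm{AVG}=\mathrm{OPT}/n$. For each $i$, $I_i=\{(a,b): a\prec_{\pi_i}b,\ b\prec_{\sigma^*}a\}$ (so $|I_i|=\kappa(\pi_i,\sigma^*)$), and $\sigma_i\in\mathcal{F}$ is a closest fair ranking to $\pi_i$, i.e. minimizes $\kappa(\pi_i,\cdot)$ over $\mathcal{F}$.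
   Formalization: The parameter β ranges over the rationals in the interval [0,1]. -}

module Defs where

open import Data.Nat using (ℕ; _≤_)
open import Data.Fin using (Fin; _<?_)
open import Data.Fin.Permutation using (Permutation′; _⟨$⟩ʳ_)
open import Data.Product using (_×_; _,_)
open import Data.List using (List; length; filter; cartesianProduct; allFin; map)
open import Data.Nat.ListAction using (sum)
open import Relation.Nullary.Decidable using (_×-dec_)
open import Data.Integer using (+_)
open import Data.Rational using (ℚ; _/_)

-- A ranking of [d] (items Fin d). Convention: π ⟨$⟩ʳ a is the position
-- of item a in π (position 0 = first).
Ranking : ℕ → Set
Ranking d = Permutation′ d

_≺[_]_ : ∀ {d} → Fin d → Ranking d → Fin d → Set
a ≺[ π ] b = Data.Fin._<_ (π ⟨$⟩ʳ a) (π ⟨$⟩ʳ b)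

inversions : ∀ {d} → Ranking d → Ranking d → List (Fin d × Fin d)
inversions {d} π σ =
  filter (λ { (a , b) → ((π ⟨$⟩ʳ a) <? (π ⟨$⟩ʳ b)) ×-dec ((σ ⟨$⟩ʳ b) <? (σ ⟨$⟩ʳ a)) })
         (cartesianProduct (allFin d) (allFin d))

κ : ∀ {d} → Ranking d → Ranking d → ℕ
κ π σ = length (inversions π σ)

Obj : ∀ {d n} → (Fin n → Ranking d) → Ranking d → ℕ
Obj {n = n} S σ = sum (map (λ j → κ σ (S j)) (allFin n))

ℕ→ℚ : ℕ → ℚ
ℕ→ℚ k = + k / 1

-- σ* is fair and σᵢ is a fair ranking closest to πᵢ, so κ(πᵢ, σᵢ) ≤ |Iᵢ|, and
-- the triangle inequality for the Kendall tau distance gives κ(σᵢ, σ*) ≤ 2|Iᵢ|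
-- and κ(σᵢ, πⱼ) ≤ 2|Iᵢ| + κ(σ*, πⱼ). Summing over j,
-- Obj(σᵢ) ≤ 2n|Iᵢ| + OPT ≤ 2(1 - β) OPT + OPT.
-- Symmetry of κ, used in the first step, is double counting: swapping the two
-- items of a pair maps the inversions of (π, σ) onto those of (σ, π).
module Submission where

open import Defs
open import Data.Nat using (ℕ; NonZero; suc; z≤n; s≤s)
open import Data.Fin using (Fin)
open import Data.List using (List; []; _∷_; _++_; length; filter; cartesianProduct; allFin; map)
open import Data.Integer using (+_)
open import Data.Rational using (ℚ; _/_; _≤_; _+_; _*_; _-_; 0ℚ; 1ℚ; toℚᵘ)

import Data.Nat as ℕ
import Data.Nat.Properties as ℕ
open import Data.Nat.ListAction using (sum)
open import Data.Nat.ListAction.Properties using (sum-++)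
open import Data.Nat.Tactic.RingSolver using (solve-∀)
import Data.Fin.Properties as Fin
open import Data.Fin.Permutation using (_⟨$⟩ʳ_)
open import Data.List.Properties using (map-++; map-∘; map-cong; length-tabulate)
open import Data.Product using (_×_; _,_; swap)
open import Data.Sum using (_⊎_; inj₁; inj₂)
open import Function using (_⇔_; mk⇔; Equivalence; Injection)
open import Function.Properties.Inverse using (↔⇒↣)
open import Relation.Nullary using (Dec; yes; no; contradiction)
open import Relation.Unary using (Pred; Decidable)
open import Relation.Binary using (tri<; tri≈; tri>)
open import Relation.Binary.PropositionalEquality
import Data.Rational.Properties as ℚ
open import Data.Rational.Unnormalised as ℚᵘ using (mkℚᵘ; *≡*; *≤*)
import Data.Rational.Unnormalised.Properties as ℚᵘ
import Data.Integer as ℤ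
import Data.Integer.Properties as ℤ
open import Data.Rational.Solver using (module +-*-Solver)

∑ : ∀ {A : Set} → List A → (A → ℕ) → ℕ
∑ xs f = sum (map f xs)

syntax ∑ xs (λ x → e) = ∑[ x ∈ xs ] e

module _ {A : Set} where

  ∑-mono : ∀ {f g : A → ℕ} → (∀ x → f x ℕ.≤ g x) → ∀ xs → ∑ xs f ℕ.≤ ∑ xs g
  ∑-mono f≤g []       = z≤n
  ∑-mono f≤g (x ∷ xs) = ℕ.+-mono-≤ (f≤g x) (∑-mono f≤g xs)

  ∑-+ : ∀ (f g : A → ℕ) xs → ∑[ x ∈ xs ] (f x ℕ.+ g x) ≡ ∑ xs f ℕ.+ ∑ xs g
  ∑-+ f g []       = refl
  ∑-+ f g (x ∷ xs) = begin
    f x ℕ.+ g x ℕ.+ ∑[ x ∈ xs ] (f x ℕ.+ g x) ≡⟨ cong (f x ℕ.+ g x ℕ.+_) (∑-+ f g xs) ⟩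
    f x ℕ.+ g x ℕ.+ (∑ xs f ℕ.+ ∑ xs g)       ≡⟨ interchange (f x) (g x) (∑ xs f) (∑ xs g) ⟩
    f x ℕ.+ ∑ xs f ℕ.+ (g x ℕ.+ ∑ xs g)       ∎
    where
    open ≡-Reasoning
    interchange : ∀ a b c d → a ℕ.+ b ℕ.+ (c ℕ.+ d) ≡ a ℕ.+ c ℕ.+ (b ℕ.+ d)
    interchange = solve-∀

  ∑-const : ∀ c (xs : List A) → ∑[ x ∈ xs ] c ≡ length xs ℕ.* c
  ∑-const c []       = refl
  ∑-const c (x ∷ xs) = cong (c ℕ.+_) (∑-const c xs)

module _ {A B : Set} where

  ∑-cartesianProduct : ∀ (g : A × B → ℕ) xs ys →
    ∑ (cartesianProduct xs ys) g ≡ ∑[ x ∈ xs ] ∑[ y ∈ ys ] g (x , y)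
  ∑-cartesianProduct g []       ys = refl
  ∑-cartesianProduct g (x ∷ xs) ys = begin
    sum (map g (map (x ,_) ys ++ cartesianProduct xs ys))
      ≡⟨ cong sum (map-++ g (map (x ,_) ys) (cartesianProduct xs ys)) ⟩
    sum (map g (map (x ,_) ys) ++ map g (cartesianProduct xs ys))
      ≡⟨ sum-++ (map g (map (x ,_) ys)) _ ⟩
    sum (map g (map (x ,_) ys)) ℕ.+ ∑ (cartesianProduct xs ys) g
      ≡⟨ cong₂ ℕ._+_ (cong sum (sym (map-∘ ys))) (∑-cartesianProduct g xs ys) ⟩
    ∑[ y ∈ ys ] g (x , y) ℕ.+ ∑[ x ∈ xs ] ∑[ y ∈ ys ] g (x , y) ∎
    where open ≡-Reasoning

  ∑-comm : ∀ (h : A → B → ℕ) xs ys →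
    ∑[ x ∈ xs ] ∑[ y ∈ ys ] h x y ≡ ∑[ y ∈ ys ] ∑[ x ∈ xs ] h x y
  ∑-comm h []       ys = sym (trans (∑-const 0 ys) (ℕ.*-zeroʳ (length ys)))
  ∑-comm h (x ∷ xs) ys = begin
    ∑[ y ∈ ys ] h x y ℕ.+ ∑[ x ∈ xs ] ∑[ y ∈ ys ] h x y
      ≡⟨ cong (∑[ y ∈ ys ] h x y ℕ.+_) (∑-comm h xs ys) ⟩
    ∑[ y ∈ ys ] h x y ℕ.+ ∑[ y ∈ ys ] ∑[ x ∈ xs ] h x y
      ≡⟨ ∑-+ (h x) (λ y → ∑[ x ∈ xs ] h x y) ys ⟨
    ∑[ y ∈ ys ] (h x y ℕ.+ ∑[ x ∈ xs ] h x y) ∎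
    where open ≡-Reasoning

indicator : ∀ {P : Set} → Dec P → ℕ
indicator (yes _) = 1
indicator (no _)  = 0

indicator-cong : ∀ {P Q : Set} (P? : Dec P) (Q? : Dec Q) → P ⇔ Q → indicator P? ≡ indicator Q?
indicator-cong (yes _) (yes _) P⇔Q = refl
indicator-cong (yes p) (no ¬q) P⇔Q = contradiction (Equivalence.to P⇔Q p) ¬q
indicator-cong (no ¬p) (yes q) P⇔Q = contradiction (Equivalence.from P⇔Q q) ¬p
indicator-cong (no _)  (no _)  P⇔Q = refl

indicator-∪ : ∀ {P Q R : Set} (P? : Dec P) (Q? : Dec Q) (R? : Dec R) → (P → Q ⊎ R) →
  indicator P? ℕ.≤ indicator Q? ℕ.+ indicator R?
indicator-∪ (no _)  Q?      R?      P⇒Q∪R = z≤n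
indicator-∪ (yes p) (yes _) R?      P⇒Q∪R = s≤s z≤n
indicator-∪ (yes p) (no _)  (yes _) P⇒Q∪R = s≤s z≤n
indicator-∪ (yes p) (no ¬q) (no ¬r) P⇒Q∪R with P⇒Q∪R p
... | inj₁ q = contradiction q ¬q
... | inj₂ r = contradiction r ¬r

module _ {A : Set} where

  length-filter≡∑-indicator : ∀ {P : Pred A _} (P? : Decidable P) xs →
    length (filter P? xs) ≡ ∑[ x ∈ xs ] indicator (P? x)
  length-filter≡∑-indicator P? []       = refl
  length-filter≡∑-indicator P? (x ∷ xs) with P? x
  ... | yes _ = cong suc (length-filter≡∑-indicator P? xs)
  ... | no _  = length-filter≡∑-indicator P? xs

  length-filter-∪ : ∀ {P Q R : Pred A _} (P? : Decidable P) (Q? : Decidable Q) (R? : Decidable R) →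
    (∀ x → P x → Q x ⊎ R x) → ∀ xs →
    length (filter P? xs) ℕ.≤ length (filter Q? xs) ℕ.+ length (filter R? xs)
  length-filter-∪ P? Q? R? P⊆Q∪R xs = begin
    length (filter P? xs)                             ≡⟨ length-filter≡∑-indicator P? xs ⟩
    ∑[ x ∈ xs ] indicator (P? x)                      ≤⟨ ∑-mono (λ x → indicator-∪ (P? x) (Q? x) (R? x) (P⊆Q∪R x)) xs ⟩
    ∑[ x ∈ xs ] (indicator (Q? x) ℕ.+ indicator (R? x)) ≡⟨ ∑-+ _ _ xs ⟩
    ∑[ x ∈ xs ] indicator (Q? x) ℕ.+ ∑[ x ∈ xs ] indicator (R? x)
      ≡⟨ cong₂ ℕ._+_ (length-filter≡∑-indicator Q? xs) (length-filter≡∑-indicator R? xs) ⟨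
    length (filter Q? xs) ℕ.+ length (filter R? xs) ∎
    where open ℕ.≤-Reasoning

length-filter-cartesianProduct-swap : ∀ {A B : Set} {P : Pred (A × B) _} {Q : Pred (B × A) _}
  (P? : Decidable P) (Q? : Decidable Q) → (∀ x y → P (x , y) ⇔ Q (y , x)) → ∀ xs ys →
  length (filter P? (cartesianProduct xs ys)) ≡ length (filter Q? (cartesianProduct ys xs))
length-filter-cartesianProduct-swap P? Q? P⇔Q xs ys = begin
  length (filter P? (cartesianProduct xs ys))         ≡⟨ length-filter≡∑-indicator P? (cartesianProduct xs ys) ⟩
  ∑ (cartesianProduct xs ys) (λ p → indicator (P? p)) ≡⟨ ∑-cartesianProduct _ xs ys ⟩
  ∑[ x ∈ xs ] ∑[ y ∈ ys ] indicator (P? (x , y))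
    ≡⟨ cong sum (map-cong (λ x → cong sum (map-cong (λ y → indicator-cong _ _ (P⇔Q x y)) ys)) xs) ⟩
  ∑[ x ∈ xs ] ∑[ y ∈ ys ] indicator (Q? (y , x))      ≡⟨ ∑-comm _ xs ys ⟩
  ∑[ y ∈ ys ] ∑[ x ∈ xs ] indicator (Q? (y , x))      ≡⟨ ∑-cartesianProduct _ ys xs ⟨
  ∑ (cartesianProduct ys xs) (λ p → indicator (Q? p)) ≡⟨ length-filter≡∑-indicator Q? (cartesianProduct ys xs) ⟨
  length (filter Q? (cartesianProduct ys xs))         ∎
  where open ≡-Reasoning

module _ {d : ℕ} where

  ⟨$⟩ʳ-injective : ∀ (π : Ranking d) {a b} → π ⟨$⟩ʳ a ≡ π ⟨$⟩ʳ b → a ≡ b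
  ⟨$⟩ʳ-injective π = Injection.injective (↔⇒↣ π)

  κ-sym : ∀ (π σ : Ranking d) → κ π σ ≡ κ σ π
  κ-sym π σ = length-filter-cartesianProduct-swap _ _ (λ a b → mk⇔ swap swap) (allFin d) (allFin d)

  Inverted : Ranking d → Ranking d → Fin d → Fin d → Set
  Inverted π σ a b = a ≺[ π ] b × b ≺[ σ ] a

  Inverted-split : ∀ (π σ ρ : Ranking d) {a b} →
    Inverted π ρ a b → Inverted π σ a b ⊎ Inverted σ ρ a b
  Inverted-split π σ ρ {a} {b} (πa<πb , ρb<ρa) with Fin.<-cmp (σ ⟨$⟩ʳ a) (σ ⟨$⟩ʳ b)
  ... | tri< σa<σb _ _ = inj₂ (σa<σb , ρb<ρa)
  ... | tri> _ _ σb<σa = inj₁ (πa<πb , σb<σa)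
  ... | tri≈ _ σa≡σb _ = contradiction (cong (π ⟨$⟩ʳ_) (⟨$⟩ʳ-injective σ σa≡σb)) (Fin.<⇒≢ πa<πb)

  κ-triangle : ∀ (π σ ρ : Ranking d) → κ π ρ ℕ.≤ κ π σ ℕ.+ κ σ ρ
  κ-triangle π σ ρ = length-filter-∪ _ _ _ (λ { (a , b) → Inverted-split π σ ρ })
                                     (cartesianProduct (allFin d) (allFin d))

  Obj-triangle : ∀ {n} (S : Fin n → Ranking d) (σ τ : Ranking d) →
    Obj S σ ℕ.≤ n ℕ.* κ σ τ ℕ.+ Obj S τ
  Obj-triangle {n} S σ τ = begin
    Obj S σ                                        ≤⟨ ∑-mono (λ j → κ-triangle σ τ (S j)) (allFin n) ⟩
    ∑[ j ∈ allFin n ] (κ σ τ ℕ.+ κ τ (S j))        ≡⟨ ∑-+ _ _ (allFin n) ⟩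
    ∑[ j ∈ allFin n ] κ σ τ ℕ.+ Obj S τ            ≡⟨ cong (ℕ._+ Obj S τ) (∑-const (κ σ τ) (allFin n)) ⟩
    length (allFin n) ℕ.* κ σ τ ℕ.+ Obj S τ        ≡⟨ cong (λ m → m ℕ.* κ σ τ ℕ.+ Obj S τ) (length-tabulate {n = n} (λ j → j)) ⟩
    n ℕ.* κ σ τ ℕ.+ Obj S τ                        ∎
    where open ℕ.≤-Reasoning

  κ-closer-≤ : ∀ (π σ τ : Ranking d) → κ π σ ℕ.≤ κ π τ → κ σ τ ℕ.≤ 2 ℕ.* κ π τ
  κ-closer-≤ π σ τ closer = begin
    κ σ τ               ≤⟨ κ-triangle σ π τ ⟩
    κ σ π ℕ.+ κ π τ     ≡⟨ cong (ℕ._+ κ π τ) (κ-sym σ π) ⟩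
    κ π σ ℕ.+ κ π τ     ≤⟨ ℕ.+-monoˡ-≤ (κ π τ) closer ⟩
    κ π τ ℕ.+ κ π τ     ≡⟨ cong (κ π τ ℕ.+_) (ℕ.+-identityʳ (κ π τ)) ⟨
    2 ℕ.* κ π τ         ∎
    where open ℕ.≤-Reasoning

toℚᵘ-ℕ→ℚ : ∀ k → toℚᵘ (ℕ→ℚ k) ℚᵘ.≃ mkℚᵘ (+ k) 0
toℚᵘ-ℕ→ℚ k = ℚ.toℚᵘ-fromℚᵘ (mkℚᵘ (+ k) 0)

ℕ→ℚ-+ : ∀ x y → ℕ→ℚ (x ℕ.+ y) ≡ ℕ→ℚ x + ℕ→ℚ y
ℕ→ℚ-+ x y = ℚ.toℚᵘ-injective (begin
  toℚᵘ (ℕ→ℚ (x ℕ.+ y))              ≈⟨ toℚᵘ-ℕ→ℚ (x ℕ.+ y) ⟩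
  mkℚᵘ (+ (x ℕ.+ y)) 0              ≈⟨ *≡* (cong (ℤ._* + 1) (trans (ℤ.pos-+ x y)
                                         (sym (cong₂ ℤ._+_ (ℤ.*-identityʳ (+ x)) (ℤ.*-identityʳ (+ y)))))) ⟩
  mkℚᵘ (+ x) 0 ℚᵘ.+ mkℚᵘ (+ y) 0    ≈⟨ ℚᵘ.+-cong (toℚᵘ-ℕ→ℚ x) (toℚᵘ-ℕ→ℚ y) ⟨
  toℚᵘ (ℕ→ℚ x) ℚᵘ.+ toℚᵘ (ℕ→ℚ y)    ≈⟨ ℚ.toℚᵘ-homo-+ (ℕ→ℚ x) (ℕ→ℚ y) ⟨
  toℚᵘ (ℕ→ℚ x + ℕ→ℚ y)              ∎)
  where open ℚᵘ.≃-Reasoning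

ℕ→ℚ-* : ∀ x y → ℕ→ℚ (x ℕ.* y) ≡ ℕ→ℚ x * ℕ→ℚ y
ℕ→ℚ-* x y = ℚ.toℚᵘ-injective (begin
  toℚᵘ (ℕ→ℚ (x ℕ.* y))              ≈⟨ toℚᵘ-ℕ→ℚ (x ℕ.* y) ⟩
  mkℚᵘ (+ (x ℕ.* y)) 0              ≈⟨ *≡* (cong (ℤ._* + 1) (ℤ.pos-* x y)) ⟩
  mkℚᵘ (+ x) 0 ℚᵘ.* mkℚᵘ (+ y) 0    ≈⟨ ℚᵘ.*-cong (toℚᵘ-ℕ→ℚ x) (toℚᵘ-ℕ→ℚ y) ⟨
  toℚᵘ (ℕ→ℚ x) ℚᵘ.* toℚᵘ (ℕ→ℚ y)    ≈⟨ ℚ.toℚᵘ-homo-* (ℕ→ℚ x) (ℕ→ℚ y) ⟨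
  toℚᵘ (ℕ→ℚ x * ℕ→ℚ y)              ∎)
  where open ℚᵘ.≃-Reasoning

ℕ→ℚ-mono-≤ : ∀ {x y} → x ℕ.≤ y → ℕ→ℚ x ≤ ℕ→ℚ y
ℕ→ℚ-mono-≤ {x} {y} x≤y = ℚ.toℚᵘ-cancel-≤ (begin
  toℚᵘ (ℕ→ℚ x)  ≃⟨ toℚᵘ-ℕ→ℚ x ⟩
  mkℚᵘ (+ x) 0  ≤⟨ *≤* (ℤ.*-monoʳ-≤-nonNeg (+ 1) (ℤ.+≤+ x≤y)) ⟩
  mkℚᵘ (+ y) 0  ≃⟨ toℚᵘ-ℕ→ℚ y ⟨
  toℚᵘ (ℕ→ℚ y)  ∎)
  where open ℚᵘ.≤-Reasoning

n*[o/n]≡o : ∀ n o .{{_ : NonZero n}} → ℕ→ℚ n * (+ o / n) ≡ ℕ→ℚ o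
n*[o/n]≡o n@(suc n-1) o = ℚ.toℚᵘ-injective (begin
  toℚᵘ (ℕ→ℚ n * (+ o / n))          ≈⟨ ℚ.toℚᵘ-homo-* (ℕ→ℚ n) (+ o / n) ⟩
  toℚᵘ (ℕ→ℚ n) ℚᵘ.* toℚᵘ (+ o / n)  ≈⟨ ℚᵘ.*-cong (toℚᵘ-ℕ→ℚ n) (ℚ.toℚᵘ-fromℚᵘ (mkℚᵘ (+ o) n-1)) ⟩
  mkℚᵘ (+ n) 0 ℚᵘ.* mkℚᵘ (+ o) n-1  ≈⟨ *≡* (trans (ℤ.*-identityʳ (+ n ℤ.* + o))
                                         (trans (ℤ.*-comm (+ n) (+ o)) (cong (λ k → + o ℤ.* + k) (sym (ℕ.*-identityˡ n))))) ⟩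
  mkℚᵘ (+ o) 0                      ≈⟨ toℚᵘ-ℕ→ℚ o ⟨
  toℚᵘ (ℕ→ℚ o)                      ∎)
  where open ℚᵘ.≃-Reasoning

lemma2 : ∀ {d n : ℕ} .{{_ : NonZero n}}
         (Fair : Ranking d → Set)
         (S : Fin n → Ranking d)
         (σ* : Ranking d) → Fair σ* →
         (∀ τ → Fair τ → Data.Nat._≤_ (Obj S σ*) (Obj S τ)) →
         (β : ℚ) → 0ℚ ≤ β → β ≤ 1ℚ →
         (i : Fin n) →
         (σᵢ : Ranking d) → Fair σᵢ →
         (∀ τ → Fair τ → Data.Nat._≤_ (κ (S i) σᵢ) (κ (S i) τ)) →
         ℕ→ℚ (length (inversions (S i) σ*)) ≤ (1ℚ - β) * ((+ Obj S σ*) / n) →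
         ℕ→ℚ (Obj S σᵢ) ≤ ((+ 3 / 1) - (+ 2 / 1) * β) * ℕ→ℚ (Obj S σ*)
lemma2 {n = n} Fair S σ* fair-σ* _ β _ _ i σᵢ _ closest |Iᵢ|≤ = begin
  ℕ→ℚ (Obj S σᵢ)                         ≤⟨ ℕ→ℚ-mono-≤ Obj-σᵢ≤ ⟩
  ℕ→ℚ (n ℕ.* (2 ℕ.* I) ℕ.+ OPT)          ≡⟨ cast ⟩
  m * (two * ℕ→ℚ I) + opt                ≤⟨ ℚ.+-monoˡ-≤ opt (ℚ.*-monoˡ-≤-nonNeg m {{ℚ.normalize-nonNeg n 1}}
                                              (ℚ.*-monoˡ-≤-nonNeg two |Iᵢ|≤)) ⟩
  m * (two * ((1ℚ - β) * avg)) + opt     ≡⟨ cong (_+_ (m * (two * ((1ℚ - β) * avg)))) (n*[o/n]≡o n OPT) ⟨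
  m * (two * ((1ℚ - β) * avg)) + m * avg ≡⟨ rearrange m β avg ⟩
  ((+ 3 / 1) - two * β) * (m * avg)      ≡⟨ cong (((+ 3 / 1) - two * β) *_) (n*[o/n]≡o n OPT) ⟩
  ((+ 3 / 1) - two * β) * opt            ∎
  where
  open ℚ.≤-Reasoning
  I OPT : ℕ
  I = κ (S i) σ*
  OPT = Obj S σ*
  m opt avg two : ℚ
  m = ℕ→ℚ n
  opt = ℕ→ℚ OPT
  avg = (+ OPT) / n
  two = + 2 / 1

  Obj-σᵢ≤ : Obj S σᵢ ℕ.≤ n ℕ.* (2 ℕ.* I) ℕ.+ OPT
  Obj-σᵢ≤ = ℕ.≤-trans (Obj-triangle S σᵢ σ*)
              (ℕ.+-monoˡ-≤ OPT (ℕ.*-monoʳ-≤ n (κ-closer-≤ (S i) σᵢ σ* (closest σ* fair-σ*))))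

  cast : ℕ→ℚ (n ℕ.* (2 ℕ.* I) ℕ.+ OPT) ≡ m * (two * ℕ→ℚ I) + opt
  cast = trans (ℕ→ℚ-+ (n ℕ.* (2 ℕ.* I)) OPT)
               (cong (_+ opt) (trans (ℕ→ℚ-* n (2 ℕ.* I)) (cong (m *_) (ℕ→ℚ-* 2 I))))

  rearrange : ∀ m b q → m * (two * ((1ℚ - b) * q)) + m * q ≡ ((+ 3 / 1) - two * b) * (m * q)
  rearrange = solve 3 (λ m b q → m :* (con two :* ((con 1ℚ :- b) :* q)) :+ m :* q
                                := (con (+ 3 / 1) :- con two :* b) :* (m :* q)) refl
    where open +-*-Solver
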